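{- For any integer $n\ge 6$ with $n\equiv 2\pmod 4$, $\xi(C_n\square K_2)\le \frac{5n-2}{4}$.
   Context: All graphs are finite, simple, connected and undirected; $d_G(u,v)$ is the shortest-path distance. A set $D\subseteq V(G)$ is a distance-equalizer set of $G$ if for any two vertices $x,y\in V(G)\setminus D$ there is $w\in D$ with $d_G(x,w)=d_G(y,w)$. The equidistant dimension $\xi(G)$ is the minimum cardinality of a distance-equalizer set of $G$. $C_n$ is the cycle on $n$ vertices and $K_2$ the complete graph on two vertices; $\square$ is the Cartesian product of graphs. -}

module Defs where

open import Data.Nat using (ℕ; zero; suc; _≤_)
open import Data.Fin using (Fin; toℕ)
open import Data.Bool using (Bool)
open import Data.Product using (_×_; Σ-syntax; ∃-syntax; _,_)
open import Data.Sum using (_⊎_)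
open import Data.List using (List)
open import Data.List.Membership.Propositional using (_∈_; _∉_)
open import Relation.Binary.PropositionalEquality using (_≡_; _≢_)
open import Level using (0ℓ) renaming (suc to lsuc)

record Graph : Set₁ where
  field
    V   : Set
    Adj : V → V → Set
open Graph public

data Walk (G : Graph) : V G → V G → ℕ → Set where
  here : ∀ {x} → Walk G x x zero
  step : ∀ {x y z k} → Adj G x y → Walk G y z k → Walk G x z (suc k)

Dist : (G : Graph) → V G → V G → ℕ → Set
Dist G x y k = Walk G x y k × (∀ j → Walk G x y j → k ≤ j)

CycleStep : (n : ℕ) → Fin n → Fin n → Set
CycleStep n i j = (suc (toℕ i) ≡ toℕ j) ⊎ (suc (toℕ i) ≡ n × toℕ j ≡ 0)

Cycle : ℕ → Graph
Cycle n = record { V = Fin n ; Adj = λ i j → CycleStep n i j ⊎ CycleStep n j i }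

K2 : Graph
K2 = record { V = Bool ; Adj = λ a b → a ≢ b }

_□_ : Graph → Graph → Graph
G □ H = record
  { V = V G × V H
  ; Adj = λ { (a , b) (c , d) → (Adj G a c × b ≡ d) ⊎ (a ≡ c × Adj H b d) } }

IsDistanceEqualizer : (G : Graph) → List (V G) → Set
IsDistanceEqualizer G D =
  ∀ x y → x ∉ D → y ∉ D → ∃[ w ] (w ∈ D × ∃[ k ] (Dist G x w k × Dist G y w k))

-- ξ(G) ≤ b : some distance-equalizer set has cardinality ≤ b
-- (length of a list is ≥ the cardinality of the set of its entries).
ξ≤ : (G : Graph) → (b : ℕ) → Set
ξ≤ G b = ∃[ D ] (IsDistanceEqualizer G D × Data.List.length D ≤ b)

-- Write n = 2h with h = 2m + 1, and let D contain one end of every rung, (x , not (odd x)), together with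
-- the m top vertices (x , true) with x odd and h < x; so |D| = n + m = (5n - 2)/4.  Distances in the prism
-- are the cycle distance plus the layer distance.  Two vertices outside D on the same layer sit at cycle
-- positions of equal parity, so the rung end of D over their midpoint equalizes them.  Otherwise one is an
-- even bottom vertex i and the other an odd top vertex j ≤ h, at odd distance 2t + 1.  At the two middle
-- points p and p + 1 between them the distances to i and j differ by exactly one, in opposite directions.
-- Either the rung end over one of them lies on the compensating layer, or the odd one needs the top layer:
-- then it is in D if it lies above h, and otherwise the antipode of the even one, an odd top vertex beyond h,
-- works instead, because the distances to a point and to its antipode always sum to h.

module Submission where

open import Defs
open import Data.Bool using (Bool; true; false; not; _xor_)
open import Data.Bool.Properties using (not-injective; not-distribˡ-xor; xor-same; xor-identityʳ)
open import Data.Empty using (⊥-elim)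
open import Data.Fin using (Fin; toℕ; fromℕ; fromℕ<)
open import Data.Fin.Properties using (toℕ-injective; toℕ<n; toℕ-fromℕ; toℕ-fromℕ<)
open import Data.List using (List; map; allFin; _++_; length)
open import Data.List.Membership.Propositional using (_∈_; _∉_)
open import Data.List.Membership.Propositional.Properties using (∈-map⁺; ∈-++⁺ˡ; ∈-++⁺ʳ; ∈-allFin)
open import Data.List.Properties using (length-++; length-map; length-tabulate)
open import Data.Nat
open import Data.Nat.DivMod using (m≡m%n+[m/n]*n)
open import Data.Nat.Properties
open import Data.Nat.Tactic.RingSolver using (solve-∀)
open import Data.Product using (_×_; ∃₂; ∃-syntax; _,_; proj₁; proj₂)
open import Data.Sum using (_⊎_; inj₁; inj₂; swap)
open import Relation.Binary.PropositionalEquality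
open import Relation.Nullary using (¬_; yes; no)

private
  variable
    G H : Graph

_++ʷ_ : ∀ {x y z k l} → Walk G x y k → Walk G y z l → Walk G x z (k + l)
here     ++ʷ w′ = w′
step e w ++ʷ w′ = step e (w ++ʷ w′)

reverseʷ : (∀ {x y} → Adj G x y → Adj G y x) → ∀ {x y k} → Walk G x y k → Walk G y x k
reverseʷ adj-sym here = here
reverseʷ {G} adj-sym (step {k = k} e w) =
  subst (Walk G _ _) (+-comm k 1) (reverseʷ adj-sym w ++ʷ step (adj-sym e) here)

potential≤length : (f : V G → ℕ) → (∀ {x y} → Adj G x y → f x ≤ suc (f y)) →
                   ∀ {x w k} → f w ≡ 0 → Walk G x w k → f x ≤ k
potential≤length f lip fw≡0 here = ≤-reflexive fw≡0
potential≤length f lip fw≡0 (step e w) = ≤-trans (lip e) (s≤s (potential≤length f lip fw≡0 w))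

mapˡʷ : ∀ {a b p k} → Walk G a b k → Walk (G □ H) (a , p) (b , p) k
mapˡʷ here       = here
mapˡʷ (step e w) = step (inj₁ (e , refl)) (mapˡʷ w)

mapʳʷ : ∀ {a p q k} → Walk H p q k → Walk (G □ H) (a , p) (a , q) k
mapʳʷ here       = here
mapʳʷ (step e w) = step (inj₂ (refl , e)) (mapʳʷ w)

splitʷ : ∀ {a b p q j} → Walk (G □ H) (a , p) (b , q) j →
         ∃₂ λ k l → Walk G a b k × Walk H p q l × k + l ≡ j
splitʷ here = 0 , 0 , here , here , refl
splitʷ (step {y = _ , _} (inj₁ (e , refl)) w) with splitʷ w
... | k , l , wG , wH , eq = suc k , l , step e wG , wH , cong suc eq
splitʷ (step {y = _ , _} (inj₂ (refl , e)) w) with splitʷ w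
... | k , l , wG , wH , eq = k , suc l , wG , step e wH , trans (+-suc k l) (cong suc eq)

Dist-□ : ∀ {a b p q k l} → Dist G a b k → Dist H p q l → Dist (G □ H) (a , p) (b , q) (k + l)
Dist-□ {G} {H} {a} {b} {p} {q} {k} {l} (wG , minG) (wH , minH) = mapˡʷ wG ++ʷ mapʳʷ wH , minimal
  where
  minimal : ∀ j → Walk (G □ H) (a , p) (b , q) j → k + l ≤ j
  minimal j w with splitʷ w
  ... | k′ , l′ , wG′ , wH′ , refl = +-mono-≤ (minG k′ wG′) (minH l′ wH′)

k2Dist : Bool → Bool → ℕ
k2Dist false false = 0
k2Dist true  true  = 0
k2Dist _     _     = 1

Dist-K2 : ∀ p q → Dist K2 p q (k2Dist p q)
Dist-K2 false false = here , λ _ _ → z≤n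
Dist-K2 true  true  = here , λ _ _ → z≤n
Dist-K2 false true  = step (λ ()) here , λ { .(suc _) (step _ _) → s≤s z≤n }
Dist-K2 true  false = step (λ ()) here , λ { .(suc _) (step _ _) → s≤s z≤n }

cycleDist : ℕ → ℕ → ℕ → ℕ
cycleDist n a b = ∣ a - b ∣ ⊓ (n ∸ ∣ a - b ∣)

cycleDist-sym : ∀ n a b → cycleDist n a b ≡ cycleDist n b a
cycleDist-sym n a b = cong (λ d → d ⊓ (n ∸ d)) (∣-∣-comm a b)

cycleDist-self : ∀ n a → cycleDist n a a ≡ 0
cycleDist-self n a = cong (λ d → d ⊓ (n ∸ d)) (∣n-n∣≡0 a)

cycleDist-wrap : ∀ {n x} → x ≤ n → cycleDist n n x ≡ cycleDist n 0 x
cycleDist-wrap {n} {x} x≤n = begin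
  ∣ n - x ∣ ⊓ (n ∸ ∣ n - x ∣) ≡⟨ cong (λ d → d ⊓ (n ∸ d)) (m≤n⇒∣n-m∣≡n∸m x≤n) ⟩
  (n ∸ x) ⊓ (n ∸ (n ∸ x))     ≡⟨ cong ((n ∸ x) ⊓_) (m∸[m∸n]≡n x≤n) ⟩
  (n ∸ x) ⊓ x                 ≡⟨ ⊓-comm (n ∸ x) x ⟩
  x ⊓ (n ∸ x)                 ∎
  where open ≡-Reasoning

∸-lipschitz : ∀ n {a b} → b ≤ suc a → n ∸ a ≤ suc (n ∸ b)
∸-lipschitz n {a} {b} b≤1+a = ≤-trans (∸-monoʳ-≤ (suc n) b≤1+a)
  (m≤n+o⇒m∸n≤o (suc n) b (subst (suc n ≤_) (sym (+-suc b (n ∸ b))) (s≤s (m≤n+m∸n n b))))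

cycleDist-lipschitz : ∀ n a b w → ∣ a - b ∣ ≡ 1 → cycleDist n a w ≤ suc (cycleDist n b w)
cycleDist-lipschitz n a b w ∣a-b∣≡1 =
  ⊓-mono-≤ (close a b ∣a-b∣≡1) (∸-lipschitz n (close b a (trans (∣-∣-comm b a) ∣a-b∣≡1)))
  where
  close : ∀ x y → ∣ x - y ∣ ≡ 1 → ∣ x - w ∣ ≤ suc ∣ y - w ∣
  close x y ∣x-y∣≡1 = subst (λ d → ∣ x - w ∣ ≤ d + ∣ y - w ∣) ∣x-y∣≡1 (∣-∣-triangle x y w)

cycleStep-lipschitz : ∀ {n} {i j : Fin n} w → w < n → CycleStep n i j →
  cycleDist n (toℕ i) w ≤ suc (cycleDist n (toℕ j) w) × cycleDist n (toℕ j) w ≤ suc (cycleDist n (toℕ i) w)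
cycleStep-lipschitz {n} {i} {j} w _ (inj₁ 1+i≡j) =
  cycleDist-lipschitz n (toℕ i) (toℕ j) w ∣i-j∣≡1 ,
  cycleDist-lipschitz n (toℕ j) (toℕ i) w (trans (∣-∣-comm (toℕ j) (toℕ i)) ∣i-j∣≡1)
  where
  ∣i-j∣≡1 : ∣ toℕ i - toℕ j ∣ ≡ 1
  ∣i-j∣≡1 = trans (cong ∣ toℕ i -_∣ (trans (sym 1+i≡j) (+-comm 1 (toℕ i)))) (∣m-m+n∣≡n (toℕ i) 1)
cycleStep-lipschitz {n} {i} {j} w w<n (inj₂ (1+i≡n , j≡0)) rewrite j≡0 =
  subst (_≤ suc (cycleDist n 0 w)) (sym i≈0) (cycleDist-lipschitz n 0 1 (suc w) refl) ,
  subst (λ d → cycleDist n 0 w ≤ suc d) (sym i≈0) (cycleDist-lipschitz n 1 0 (suc w) refl)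
  where
  -- Rotating by one turns the wrap-around edge (n - 1, 0) into the edge (0, 1).
  i≈0 : cycleDist n (toℕ i) w ≡ cycleDist n 0 (suc w)
  i≈0 = trans (cong (λ k → cycleDist n k (suc w)) 1+i≡n) (cycleDist-wrap w<n)

cycleAdj-lipschitz : ∀ {n} {i j : Fin n} w → w < n → Adj (Cycle n) i j →
                     cycleDist n (toℕ i) w ≤ suc (cycleDist n (toℕ j) w)
cycleAdj-lipschitz w w<n (inj₁ s) = proj₁ (cycleStep-lipschitz w w<n s)
cycleAdj-lipschitz w w<n (inj₂ s) = proj₂ (cycleStep-lipschitz w w<n s)

cycleAdj-sym : ∀ {n} {i j : Fin n} → Adj (Cycle n) i j → Adj (Cycle n) j i
cycleAdj-sym = swap

ascendʷ : ∀ {n} {a b : Fin n} k → toℕ a + k ≡ toℕ b → Walk (Cycle n) a b k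
ascendʷ {a = a} zero a+0≡b =
  subst (λ b → Walk _ a b 0) (toℕ-injective (trans (sym (+-identityʳ (toℕ a))) a+0≡b)) here
ascendʷ {n} {a} {b} (suc k) a+1+k≡b = step (inj₁ (inj₁ (sym (toℕ-fromℕ< 1+a<n)))) (ascendʷ k next+k≡b)
  where
  1+a+k≡b : suc (toℕ a) + k ≡ toℕ b
  1+a+k≡b = trans (sym (+-suc (toℕ a) k)) a+1+k≡b
  1+a<n : suc (toℕ a) < n
  1+a<n = ≤-<-trans (≤-trans (m≤m+n (suc (toℕ a)) k) (≤-reflexive 1+a+k≡b)) (toℕ<n b)
  next+k≡b : toℕ (fromℕ< 1+a<n) + k ≡ toℕ b
  next+k≡b = trans (cong (_+ k) (toℕ-fromℕ< 1+a<n)) 1+a+k≡b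

wrapAdj : ∀ {n} → Adj (Cycle (suc n)) (fromℕ n) Fin.zero
wrapAdj {n} = inj₁ (inj₂ (cong suc (toℕ-fromℕ n) , refl))

around-length : ∀ {n a d b} → a + d ≡ b → b ≤ n → n ∸ b + suc a ≡ suc n ∸ d
around-length {n} {a} {d} refl a+d≤n with m≤n⇒∃[o]m+o≡n a+d≤n
... | e , refl = begin
  a + d + e ∸ (a + d) + suc a ≡⟨ cong (_+ suc a) (m+n∸m≡n (a + d) e) ⟩
  e + suc a                   ≡⟨ sym (m+n∸m≡n d (e + suc a)) ⟩
  d + (e + suc a) ∸ d         ≡⟨ cong (_∸ d) (regroup a d e) ⟩
  suc (a + d + e) ∸ d         ∎
  where
  open ≡-Reasoning
  regroup : ∀ a d e → d + (e + suc a) ≡ suc (a + d + e)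
  regroup = solve-∀

aroundʷ : ∀ {n} {a b : Fin (suc n)} d → toℕ a + d ≡ toℕ b → Walk (Cycle (suc n)) b a (suc n ∸ d)
aroundʷ {n} {a} {b} d a+d≡b = subst (Walk _ b a) (around-length a+d≡b b≤n)
  (ascendʷ (n ∸ toℕ b) (trans (m+[n∸m]≡n b≤n) (sym (toℕ-fromℕ n))) ++ʷ step wrapAdj (ascendʷ (toℕ a) refl))
  where
  b≤n : toℕ b ≤ n
  b≤n = s≤s⁻¹ (toℕ<n b)

cycleDist-+ : ∀ n a d → cycleDist n a (a + d) ≡ d ⊓ (n ∸ d)
cycleDist-+ n a d = cong (λ x → x ⊓ (n ∸ x)) (∣m-m+n∣≡n a d)

cycleWalk-≤ : ∀ {n} {a b : Fin (suc n)} d → toℕ a + d ≡ toℕ b →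
              Walk (Cycle (suc n)) a b (cycleDist (suc n) (toℕ a) (toℕ b))
cycleWalk-≤ {n} {a} {b} d a+d≡b rewrite sym a+d≡b | cycleDist-+ (suc n) (toℕ a) d with d ≤? suc n ∸ d
... | yes short = subst (Walk _ a b) (sym (m≤n⇒m⊓n≡m short)) (ascendʷ d a+d≡b)
... | no long   = subst (Walk _ a b) (sym (m≥n⇒m⊓n≡n (≰⇒≥ long))) (reverseʷ cycleAdj-sym (aroundʷ d a+d≡b))

cycleWalk : ∀ {n} (a b : Fin (suc n)) → Walk (Cycle (suc n)) a b (cycleDist (suc n) (toℕ a) (toℕ b))
cycleWalk {n} a b with ≤-total (toℕ a) (toℕ b)
... | inj₁ a≤b = let d , a+d≡b = m≤n⇒∃[o]m+o≡n a≤b in cycleWalk-≤ d a+d≡b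
... | inj₂ b≤a = let d , b+d≡a = m≤n⇒∃[o]m+o≡n b≤a in
  subst (Walk _ a b) (cycleDist-sym (suc n) (toℕ b) (toℕ a)) (reverseʷ cycleAdj-sym (cycleWalk-≤ d b+d≡a))

Dist-Cycle : ∀ {n} (a b : Fin (suc n)) → Dist (Cycle (suc n)) a b (cycleDist (suc n) (toℕ a) (toℕ b))
Dist-Cycle {n} a b = cycleWalk a b , λ _ → potential≤length (λ x → cycleDist (suc n) (toℕ x) (toℕ b))
  (cycleAdj-lipschitz (toℕ b) (toℕ<n b)) (cycleDist-self (suc n) (toℕ b))

odd : ℕ → Bool
odd zero    = false
odd (suc a) = not (odd a)

odd-+ : ∀ a b → odd (a + b) ≡ odd a xor odd b
odd-+ zero    b = refl
odd-+ (suc a) b = trans (cong not (odd-+ a b)) (not-distribˡ-xor (odd a) (odd b))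

odd-double : ∀ k → odd (k + k) ≡ false
odd-double k = trans (odd-+ k k) (xor-same (odd k))

mutual
  even⇒double : ∀ a → odd a ≡ false → ∃[ k ] a ≡ k + k
  even⇒double zero    _    = 0 , refl
  even⇒double (suc a) even with odd⇒1+double a (not-injective even)
  ... | k , refl = suc k , cong suc (sym (+-suc k k))

  odd⇒1+double : ∀ a → odd a ≡ true → ∃[ k ] a ≡ suc (k + k)
  odd⇒1+double (suc a) odd′ with even⇒double a (not-injective odd′)
  ... | k , refl = k , refl

odd-gap : ∀ {a b} → a ≤ b → odd a ≢ odd b → ∃[ t ] a + suc (t + t) ≡ b
odd-gap {a} a≤b odd-a≢odd-b with m≤n⇒∃[o]m+o≡n a≤b
... | d , refl with odd d in odd-d
...   | false = ⊥-elim (odd-a≢odd-b (sym (trans (odd-+ a d) (trans (cong (odd a xor_) odd-d) (xor-identityʳ (odd a))))))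
...   | true  = let t , d≡1+2t = odd⇒1+double d odd-d in t , cong (a +_) (sym d≡1+2t)

double-cancel-< : ∀ {a b} → a + a < b + b → a < b
double-cancel-< {a} {b} a+a<b+b with a <? b
... | yes a<b = a<b
... | no  a≮b = ⊥-elim (<⇒≱ a+a<b+b (+-mono-≤ (≮⇒≥ a≮b) (≮⇒≥ a≮b)))

odd⇒nonZero : ∀ {a} → odd a ≡ true → 0 < a
odd⇒nonZero {suc _} _ = s≤s z≤n

false≢true : false ≢ true
false≢true ()

midpoint-between : ∀ {i j s} → i + j ≡ s + s → s ≤ i ⊎ s ≤ j
midpoint-between {i} {j} {s} i+j≡s+s with ≤-total s i
... | inj₁ s≤i = inj₁ s≤i
... | inj₂ i≤s = inj₂ (+-cancelˡ-≤ s s j (subst (_≤ s + j) i+j≡s+s (+-monoˡ-≤ j i≤s)))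

∣-∣-midpoint : ∀ {i j s} → s ≤ i → i + j ≡ s + s → ∣ i - s ∣ ≡ ∣ j - s ∣
∣-∣-midpoint {i} {j} {s} s≤i i+j≡s+s with m≤n⇒∃[o]m+o≡n s≤i
... | e , refl with +-cancelˡ-≡ s (e + j) s (trans (sym (+-assoc s e j)) i+j≡s+s)
...   | e+j≡s rewrite sym (trans (+-comm j e) e+j≡s) =
  trans (∣-∣-comm (j + e + e) (j + e)) (trans (∣m-m+n∣≡n (j + e) e) (sym (∣m-m+n∣≡n j e)))

m+n+[1+n]≡m+[1+[n+n]] : ∀ m n → m + n + suc n ≡ m + suc (n + n)
m+n+[1+n]≡m+[1+[n+n]] = solve-∀

1+[m+n]+n≡m+[1+[n+n]] : ∀ m n → suc (m + n) + n ≡ m + suc (n + n)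
1+[m+n]+n≡m+[1+[n+n]] = solve-∀

module Prism4m+2 (m : ℕ) where

  h n : ℕ
  h = suc (m + m)
  n = h + h

  Prism : Graph
  Prism = Cycle n □ K2

  dist : ℕ → ℕ → ℕ
  dist = cycleDist n

  δ : V Prism → V Prism → ℕ
  δ (a , p) (b , q) = dist (toℕ a) (toℕ b) + k2Dist p q

  Dist-Prism : ∀ x w → Dist Prism x w (δ x w)
  Dist-Prism (a , p) (b , q) = Dist-□ (Dist-Cycle a b) (Dist-K2 p q)

  dist-near : ∀ {a d b} → a + d ≡ b → d ≤ h → dist a b ≡ d
  dist-near {a} {d} refl d≤h = trans (cycleDist-+ n a d) (m≤n⇒m⊓n≡m d≤n∸d)
    where
    d≤n∸d : d ≤ n ∸ d
    d≤n∸d = ≤-trans d≤h (subst (h ≤_) (sym (+-∸-assoc h d≤h)) (m≤m+n h (h ∸ d)))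

  dist-near˘ : ∀ {a d b} → b + d ≡ a → d ≤ h → dist a b ≡ d
  dist-near˘ {a} {d} {b} b+d≡a d≤h = trans (cycleDist-sym n a b) (dist-near b+d≡a d≤h)

  dist-far : ∀ {a d b e} → a + d ≡ b → d + e ≡ n → e ≤ h → dist a b ≡ e
  dist-far {a} {d} {_} {e} refl d+e≡n e≤h = begin
    cycleDist n a (a + d) ≡⟨ cycleDist-+ n a d ⟩
    d ⊓ (n ∸ d)           ≡⟨ cong (d ⊓_) (trans (cong (_∸ d) (sym d+e≡n)) (m+n∸m≡n d e)) ⟩
    d ⊓ e                 ≡⟨ m≥n⇒m⊓n≡n (≤-trans e≤h h≤d) ⟩
    e                     ∎
    where
    open ≡-Reasoning
    h≤d : h ≤ d
    h≤d = +-cancelʳ-≤ e h d (subst (h + e ≤_) (sym d+e≡n) (+-monoʳ-≤ h e≤h))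

  h+u+[h∸u]≡n : ∀ {u} → u ≤ h → h + u + (h ∸ u) ≡ n
  h+u+[h∸u]≡n {u} u≤h = trans (+-assoc h u (h ∸ u)) (cong (h +_) (m+[n∸m]≡n u≤h))

  dist-antipode : ∀ {a x} → a < n → x < h → dist a (x + h) + dist a x ≡ h
  dist-antipode {a} {x} a<n x<h with ≤-total a x | ≤-total a (x + h)
  ... | inj₁ a≤x | _ = begin
    dist a (x + h) + dist a x ≡⟨ cong₂ _+_ (dist-far a+[h+u]≡x+h (h+u+[h∸u]≡n u≤h) (m∸n≤m h u))
                                           (dist-near a+u≡x u≤h) ⟩
    (h ∸ u) + u               ≡⟨ m∸n+n≡m u≤h ⟩
    h                         ∎
    where
    open ≡-Reasoning
    u = proj₁ (m≤n⇒∃[o]m+o≡n a≤x)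
    a+u≡x : a + u ≡ x
    a+u≡x = proj₂ (m≤n⇒∃[o]m+o≡n a≤x)
    u≤h : u ≤ h
    u≤h = ≤-trans (m≤n+m u a) (≤-trans (≤-reflexive a+u≡x) (<⇒≤ x<h))
    a+[h+u]≡x+h : a + (h + u) ≡ x + h
    a+[h+u]≡x+h = trans (cong (a +_) (+-comm h u)) (trans (sym (+-assoc a u h)) (cong (_+ h) a+u≡x))
  ... | inj₂ x≤a | inj₁ a≤x+h = begin
    dist a (x + h) + dist a x ≡⟨ cong₂ _+_ (dist-near a+[h∸u]≡x+h (m∸n≤m h u)) (dist-near˘ x+u≡a u≤h) ⟩
    (h ∸ u) + u               ≡⟨ m∸n+n≡m u≤h ⟩
    h                         ∎
    where
    open ≡-Reasoning
    u = proj₁ (m≤n⇒∃[o]m+o≡n x≤a)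
    x+u≡a : x + u ≡ a
    x+u≡a = proj₂ (m≤n⇒∃[o]m+o≡n x≤a)
    u≤h : u ≤ h
    u≤h = +-cancelˡ-≤ x u h (subst (_≤ x + h) (sym x+u≡a) a≤x+h)
    a+[h∸u]≡x+h : a + (h ∸ u) ≡ x + h
    a+[h∸u]≡x+h = trans (cong (_+ (h ∸ u)) (sym x+u≡a))
                        (trans (+-assoc x u (h ∸ u)) (cong (x +_) (m+[n∸m]≡n u≤h)))
  ... | inj₂ x≤a | inj₂ x+h≤a = begin
    dist a (x + h) + dist a x ≡⟨ cong₂ _+_ (dist-near˘ x+h+v≡a v≤h)
                                           (trans (cycleDist-sym n a x)
                                                  (dist-far x+[h+v]≡a (h+u+[h∸u]≡n v≤h) (m∸n≤m h v))) ⟩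
    v + (h ∸ v)               ≡⟨ m+[n∸m]≡n v≤h ⟩
    h                         ∎
    where
    open ≡-Reasoning
    v = proj₁ (m≤n⇒∃[o]m+o≡n x+h≤a)
    x+h+v≡a : x + h + v ≡ a
    x+h+v≡a = proj₂ (m≤n⇒∃[o]m+o≡n x+h≤a)
    x+[h+v]≡a : x + (h + v) ≡ a
    x+[h+v]≡a = trans (sym (+-assoc x h v)) x+h+v≡a
    v≤h : v ≤ h
    v≤h = <⇒≤ (+-cancelˡ-< h v h (≤-<-trans (≤-trans (m≤n+m (h + v) x) (≤-reflexive x+[h+v]≡a)) a<n))

  antipode-flip : ∀ {i j x} → i < n → j < n → x < h →
                  dist i x ≡ suc (dist j x) → suc (dist i (x + h)) ≡ dist j (x + h)
  antipode-flip {i} {j} {x} i<n j<n x<h below = +-cancelʳ-≡ (dist j x) _ _ (begin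
    suc (dist i (x + h)) + dist j x ≡⟨ sym (+-suc (dist i (x + h)) (dist j x)) ⟩
    dist i (x + h) + suc (dist j x) ≡⟨ cong (dist i (x + h) +_) (sym below) ⟩
    dist i (x + h) + dist i x       ≡⟨ dist-antipode i<n x<h ⟩
    h                               ≡⟨ sym (dist-antipode j<n x<h) ⟩
    dist j (x + h) + dist j x       ∎)
    where open ≡-Reasoning

  dist-midpoint : ∀ {i j s} → i + j ≡ s + s → dist i s ≡ dist j s
  dist-midpoint {i} {j} {s} i+j≡s+s with midpoint-between {i} {j} {s} i+j≡s+s
  ... | inj₁ s≤i = cong (λ d → d ⊓ (n ∸ d)) (∣-∣-midpoint {i} {j} {s} s≤i i+j≡s+s)
  ... | inj₂ s≤j = sym (cong (λ d → d ⊓ (n ∸ d)) (∣-∣-midpoint {j} {i} {s} s≤j (trans (+-comm j i) i+j≡s+s)))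

  data Marked : ℕ → Bool → Set where
    zigzag : ∀ x → Marked x (not (odd x))
    upper  : ∀ {x} → odd x ≡ true → h < x → Marked x true

  data Free : ℕ → Bool → Set where
    evenBottom : ∀ {x} → odd x ≡ false → Free x false
    oddTop     : ∀ {x} → odd x ≡ true → x ≤ h → Free x true

  unmarked⇒free : ∀ x l → ¬ Marked x l → Free x l
  unmarked⇒free x l unmarked with odd x in odd-x | l
  ... | false | false = evenBottom odd-x
  ... | false | true  = ⊥-elim (unmarked (subst (Marked x) (cong not odd-x) (zigzag x)))
  ... | true  | false = ⊥-elim (unmarked (subst (Marked x) (cong not odd-x) (zigzag x)))
  ... | true  | true with x ≤? h
  ...   | yes x≤h = oddTop odd-x x≤h
  ...   | no  x≰h = ⊥-elim (unmarked (upper odd-x (≰⇒> x≰h)))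

  Equalizer : ℕ → Bool → ℕ → Bool → Set
  Equalizer i c j c′ = ∃₂ λ x l → x < n × Marked x l × dist i x + k2Dist c l ≡ dist j x + k2Dist c′ l

  Equalizer-sym : ∀ {i c j c′} → Equalizer i c j c′ → Equalizer j c′ i c
  Equalizer-sym (x , l , x<n , marked , eq) = x , l , x<n , marked , sym eq

  equalize-level : ∀ {i j} c → i < n → j < n → odd i ≡ odd j → Equalizer i c j c
  equalize-level {i} {j} c i<n j<n odd-i≡odd-j with even⇒double (i + j) i+j-even
    where
    i+j-even : odd (i + j) ≡ false
    i+j-even = trans (odd-+ i j) (trans (cong (odd i xor_) (sym odd-i≡odd-j)) (xor-same (odd i)))
  ... | s , i+j≡s+s = s , not (odd s) , s<n , zigzag s , cong (_+ k2Dist c (not (odd s))) (dist-midpoint {i} {j} i+j≡s+s)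
    where
    s<n : s < n
    s<n with midpoint-between {i} {j} {s} i+j≡s+s
    ... | inj₁ s≤i = ≤-<-trans s≤i i<n
    ... | inj₂ s≤j = ≤-<-trans s≤j j<n

  equalize-via-top : ∀ {i j x} → x < n → Marked x true → suc (dist i x) ≡ dist j x → Equalizer i false j true
  equalize-via-top {i} {j} {x} x<n marked i-closer =
    x , true , x<n , marked , trans (+-comm (dist i x) 1) (trans i-closer (sym (+-identityʳ (dist j x))))

  equalize-via-bottom : ∀ {i j x} → x < n → Marked x false → dist i x ≡ suc (dist j x) → Equalizer i false j true
  equalize-via-bottom {i} {j} {x} x<n marked j-closer =
    x , false , x<n , marked , trans (+-identityʳ (dist i x)) (trans j-closer (+-comm 1 (dist j x)))

  equalize-via-antipode : ∀ {i j x} → i < n → j < n → odd x ≡ false → 0 < x → x < h →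
                          dist i x ≡ suc (dist j x) → Equalizer i false j true
  equalize-via-antipode {i} {j} {x} i<n j<n even-x 0<x x<h j-closer =
    equalize-via-top {i} {j} (+-monoˡ-< h x<h) (upper odd-x+h (+-monoˡ-< h 0<x)) (antipode-flip i<n j<n x<h j-closer)
    where
    odd-x+h : odd (x + h) ≡ true
    odd-x+h = trans (odd-+ x h) (cong₂ _xor_ even-x (cong not (odd-double m)))

  equalize-ascending : ∀ {i t} → odd i ≡ false → i + suc (t + t) ≤ h → Equalizer i false (i + suc (t + t)) true
  equalize-ascending {i} {t} even-i j≤h = by-parity (odd p) refl
    where
    j = i + suc (t + t)
    p = i + t
    1+t≤h : suc t ≤ h
    1+t≤h = ≤-trans (s≤s (m≤m+n t t)) (≤-trans (m≤n+m (suc (t + t)) i) j≤h)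
    t≤h : t ≤ h
    t≤h = <⇒≤ 1+t≤h
    j<n : j < n
    j<n = ≤-<-trans j≤h (m<m+n h (s≤s z≤n))
    i<n : i < n
    i<n = ≤-<-trans (m≤m+n i (suc (t + t))) j<n
    p<n : p < n
    p<n = ≤-<-trans (m≤m+n p (suc t)) (≤-<-trans (≤-reflexive (m+n+[1+n]≡m+[1+[n+n]] i t)) j<n)

    by-parity : ∀ b → odd p ≡ b → Equalizer i false j true
    by-parity false even-p = equalize-via-top {i} {j} p<n
      (subst (Marked p) (cong not even-p) (zigzag p))
      (trans (cong suc (dist-near {i} refl t≤h)) (sym (dist-near˘ (m+n+[1+n]≡m+[1+[n+n]] i t) 1+t≤h)))
    by-parity true odd-p = equalize-via-antipode i<n j<n (cong not odd-p) (s≤s z≤n) 1+p<h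
      (trans (dist-near (+-suc i t) 1+t≤h) (cong suc (sym (dist-near˘ (1+[m+n]+n≡m+[1+[n+n]] i t) t≤h))))
      where
      0<t : 0 < t
      0<t = odd⇒nonZero (trans (sym (trans (odd-+ i t) (cong (_xor odd t) even-i))) odd-p)
      1+p<h : suc p < h
      1+p<h = ≤-trans (s≤s (subst (_≤ i + (t + t)) (+-suc i t) (+-monoʳ-≤ i (+-monoˡ-≤ t 0<t))))
                      (subst (_≤ h) (+-suc i (t + t)) j≤h)

  equalize-descending : ∀ {j t} → odd j ≡ true → j ≤ h → j + suc (t + t) < n →
                        Equalizer (j + suc (t + t)) false j true
  equalize-descending {j} {t} odd-j j≤h i<n = by-parity (odd p) refl
    where
    i = j + suc (t + t)
    p = j + t
    q = suc p
    t<h : t < h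
    t<h = double-cancel-< (≤-<-trans (≤-trans (n≤1+n (t + t)) (m≤n+m (suc (t + t)) j)) i<n)
    j<n : j < n
    j<n = ≤-<-trans j≤h (m<m+n h (s≤s z≤n))
    q+t≡i : q + t ≡ i
    q+t≡i = 1+[m+n]+n≡m+[1+[n+n]] j t
    q<n : q < n
    q<n = ≤-<-trans (≤-trans (m≤m+n q t) (≤-reflexive q+t≡i)) i<n
    j-closer-to-p : dist i p ≡ suc (dist j p)
    j-closer-to-p = trans (dist-near˘ (m+n+[1+n]≡m+[1+[n+n]] j t) t<h) (cong suc (sym (dist-near {j} refl (<⇒≤ t<h))))
    i-closer-to-q : suc (dist i q) ≡ dist j q
    i-closer-to-q = trans (cong suc (dist-near˘ q+t≡i (<⇒≤ t<h))) (sym (dist-near (+-suc j t) t<h))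

    by-parity : ∀ b → odd p ≡ b → Equalizer i false j true
    by-parity true odd-p =
      equalize-via-bottom {i} {j} (<-trans (n<1+n p) q<n) (subst (Marked p) (cong not odd-p) (zigzag p)) j-closer-to-p
    by-parity false even-p with h <? q
    ... | yes h<q = equalize-via-top {i} {j} q<n (upper (cong not even-p) h<q) i-closer-to-q
    ... | no  h≮q =
      equalize-via-antipode i<n j<n even-p (≤-trans (odd⇒nonZero odd-j) (m≤m+n j t)) (≮⇒≥ h≮q) j-closer-to-p

  equalize-across : ∀ {i j} → i < n → Free i false → Free j true → Equalizer i false j true
  equalize-across {i} {j} i<n (evenBottom even-i) (oddTop odd-j j≤h) with ≤-total i j
  ... | inj₁ i≤j with odd-gap i≤j (λ odd-i≡odd-j → false≢true (trans (sym even-i) (trans odd-i≡odd-j odd-j)))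
  ...   | t , refl = equalize-ascending {i} {t} even-i j≤h
  equalize-across {i} {j} i<n (evenBottom even-i) (oddTop odd-j j≤h) | inj₂ j≤i
    with odd-gap j≤i (λ odd-j≡odd-i → false≢true (trans (sym even-i) (trans (sym odd-j≡odd-i) odd-j)))
  ...   | t , refl = equalize-descending {j} {t} odd-j j≤h i<n

  equalize : ∀ {i j c c′} → i < n → j < n → Free i c → Free j c′ → Equalizer i c j c′
  equalize i<n j<n (evenBottom even-i) (evenBottom even-j) = equalize-level false i<n j<n (trans even-i (sym even-j))
  equalize i<n j<n (oddTop odd-i _) (oddTop odd-j _)       = equalize-level true i<n j<n (trans odd-i (sym odd-j))
  equalize i<n j<n free-i@(evenBottom _) free-j@(oddTop _ _) = equalize-across i<n free-i free-j
  equalize {i} {j} i<n j<n free-i@(oddTop _ _) free-j@(evenBottom _) =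
    Equalizer-sym {j} {false} {i} {true} (equalize-across j<n free-j free-i)

  upperPos : ℕ → ℕ
  upperPos k = h + suc (suc (k + k))

  upperPos<n : ∀ {k} → k < m → upperPos k < n
  upperPos<n {k} k<m = +-monoʳ-< h (s≤s (subst (_≤ m + m) (cong suc (+-suc k k)) (+-mono-≤ k<m k<m)))

  upperPos-onto : ∀ {x} → odd x ≡ true → h < x → x < n → ∃[ k ] k < m × upperPos k ≡ x
  upperPos-onto {x} odd-x h<x x<n with odd⇒1+double x odd-x
  ... | u , refl with m≤n⇒∃[o]m+o≡n (double-cancel-< {m} {u} (s<s⁻¹ h<x))
  ...   | k , refl = k , k<m , upperPos≡ m k
    where
    upperPos≡ : ∀ m k → suc (m + m) + suc (suc (k + k)) ≡ suc (suc m + k + (suc m + k))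
    upperPos≡ = solve-∀
    k<m : k < m
    k<m = double-cancel-< (≤-trans (n≤1+n _) (s≤s⁻¹ (+-cancelˡ-< h _ _ (subst (_< n) (sym (upperPos≡ m k)) x<n))))

  zigzagVertex : Fin n → V Prism
  zigzagVertex a = a , not (odd (toℕ a))

  upperVertex : Fin m → V Prism
  upperVertex k = fromℕ< (upperPos<n (toℕ<n k)) , true

  D : List (V Prism)
  D = map zigzagVertex (allFin n) ++ map upperVertex (allFin m)

  length-D : length D ≡ n + m
  length-D = trans (length-++ (map zigzagVertex (allFin n)))
                   (cong₂ _+_ (length-map-allFin zigzagVertex) (length-map-allFin upperVertex))
    where
    length-map-allFin : ∀ {k} (f : Fin k → V Prism) → length (map f (allFin k)) ≡ k
    length-map-allFin f = trans (length-map f (allFin _)) (length-tabulate (λ a → a))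

  marked⇒∈D : ∀ {a l} → Marked (toℕ a) l → (a , l) ∈ D
  marked⇒∈D {a} (zigzag .(toℕ a)) = ∈-++⁺ˡ (∈-map⁺ zigzagVertex (∈-allFin a))
  marked⇒∈D {a} (upper odd-a h<a) with upperPos-onto odd-a h<a (toℕ<n a)
  ... | k , k<m , upperPos-k≡a = subst (λ b → (b , true) ∈ D) vertex≡a
    (∈-++⁺ʳ (map zigzagVertex (allFin n)) (∈-map⁺ upperVertex (∈-allFin (fromℕ< k<m))))
    where
    vertex≡a : fromℕ< (upperPos<n (toℕ<n (fromℕ< k<m))) ≡ a
    vertex≡a = toℕ-injective (begin
      toℕ (fromℕ< (upperPos<n (toℕ<n (fromℕ< k<m)))) ≡⟨ toℕ-fromℕ< (upperPos<n (toℕ<n (fromℕ< k<m))) ⟩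
      upperPos (toℕ (fromℕ< k<m))                   ≡⟨ cong upperPos (toℕ-fromℕ< k<m) ⟩
      upperPos k                                    ≡⟨ upperPos-k≡a ⟩
      toℕ a                                         ∎)
      where open ≡-Reasoning

  free-vertex : ∀ {a l} → (a , l) ∉ D → Free (toℕ a) l
  free-vertex {a} {l} a∉D = unmarked⇒free (toℕ a) l (λ marked → a∉D (marked⇒∈D marked))

  D-equalizes : IsDistanceEqualizer Prism D
  D-equalizes (a , c) (b , c′) a∉D b∉D
    with equalize {toℕ a} {toℕ b} (toℕ<n a) (toℕ<n b) (free-vertex a∉D) (free-vertex b∉D)
  ... | x , l , x<n , marked , eq =
    w , marked⇒∈D (subst (λ y → Marked y l) (sym (toℕ-fromℕ< x<n)) marked) ,
    δ (a , c) w , Dist-Prism (a , c) w , subst (Dist Prism (b , c′) w) (sym δ-equal) (Dist-Prism (b , c′) w)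
    where
    w : V Prism
    w = fromℕ< x<n , l
    δ-equal : δ (a , c) w ≡ δ (b , c′) w
    δ-equal = subst (λ y → dist (toℕ a) y + k2Dist c l ≡ dist (toℕ b) y + k2Dist c′ l) (sym (toℕ-fromℕ< x<n)) eq

  ξ≤-Prism : ξ≤ Prism (n + m)
  ξ≤-Prism = D , D-equalizes , ≤-reflexive length-D

mainTheorem18 : ∀ (n b : ℕ) → 6 ≤ n → n % 4 ≡ 2 → 4 * b ≡ 5 * n ∸ 2 →
    ξ≤ (Cycle n □ K2) b
mainTheorem18 n b _ n%4≡2 4b≡5n∸2 =
  subst₂ (λ n b → ξ≤ (Cycle n □ K2) b) (sym n≡4q+2) (sym b≡n+q) P.ξ≤-Prism
  where
  q = n / 4
  module P = Prism4m+2 q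
  n≡4q+2 : n ≡ P.n
  n≡4q+2 = trans (m≡m%n+[m/n]*n n 4) (trans (cong (_+ q * 4) n%4≡2) (shape q))
    where
    shape : ∀ q → 2 + q * 4 ≡ suc (q + q) + suc (q + q)
    shape = solve-∀
  b≡n+q : b ≡ P.n + q
  b≡n+q = *-cancelˡ-≡ b (P.n + q) 4 (begin
    4 * b                 ≡⟨ 4b≡5n∸2 ⟩
    5 * n ∸ 2             ≡⟨ cong (λ n → 5 * n ∸ 2) n≡4q+2 ⟩
    5 * P.n ∸ 2           ≡⟨ cong (_∸ 2) (shape q) ⟩
    2 + 4 * (P.n + q) ∸ 2 ≡⟨ m+n∸m≡n 2 (4 * (P.n + q)) ⟩
    4 * (P.n + q)         ∎)
    where
    open ≡-Reasoning
    shape : ∀ q → 5 * (suc (q + q) + suc (q + q)) ≡ 2 + 4 * (suc (q + q) + suc (q + q) + q)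
    shape = solve-∀
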